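{- Let $B=\mathbb{Q}[[Y]]$ for a sequence of indeterminates $Y$ (distinct from $q,t$), let $F\in B[[q,t]]$ have no term of degree $0$ in $t$, and let $\psi=q^m$ with $m$ a positive integer. Then: (i) the series $G=\mathbf{e}_\psi[F]_\psi$ belongs to $B[[q,t]]$, and $G-1$ has no term of degree $0$ in $t$; (ii) $\displaystyle \mathbf{e}_\psi[F]_\psi=\prod_{k=0}^{\infty}\big(1-(1-\psi)\psi^kt\,(D_\psi F)(\psi^kt)\big)^{ -1}$, the product converging formally in $B[[q,t]]$.
   Context: $B[[q,t]]=B[[q]][[t]]$ is regarded inside $\mathcal{A}[[t]]$ with $\mathcal{A}=\mathbb{Q}((q))[[Y]]$, where the composition is computed. $[n]_\psi=1+\psi+\cdots+\psi^{n-1}$ ($n\ge1$), $[0]_\psi=0$, $[n]_\psi!=[1]_\psi\cdots[n]_\psi$, $[0]_\psi!=1$; $D_\psi F(t)=\frac{F(\psi t)-F(t)}{(\psi-1)t}$. For $F$ with zero constant term in $t$: $F^{[0]_\psi}=1$ and for $k\ge1$, $F^{[k]_\psi}$ is the unique series with zero constant term in $t$ such that $D_\psi F^{[k]_\psi}=[k]_\psi F^{[k-1]_\psi}D_\psi F$; for $G(t)=\sum_kg_kt^k/[k]_\psi!$, $G[F]_\psi=\sum_kg_kF^{[k]_\psi}/[k]_\psi!$. $\mathbf{e}_\psi(t)=\sum_{n\ge0}t^n/[n]_\psi!$. Formal convergence is with respect to the $(q,t)$-adic topology. -}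

module Defs where

open import Data.Nat using (ℕ; zero; suc; _∸_; _≤_; _≡ᵇ_)
open import Data.Nat.DivMod using (_/_)
open import Data.Nat.Divisibility using (_∣?_)
open import Data.Rational using (ℚ; 0ℚ; 1ℚ)
import Data.Rational as Q
open import Data.Bool using (if_then_else_)
open import Relation.Nullary.Decidable using (does)
open import Data.Product using (Σ; ∃; _×_)
open import Relation.Binary.PropositionalEquality using (_≡_)

-- Minimal ring-operation signatures (only operations are needed:
-- all equalities in the statement are coefficientwise equalities in ℚ).

record Ops (A : Set) : Set where
  field
    𝟘 𝟙 : A
    _⊕_ _⊗_ : A → A → A
    ⊖_ : A → A

module Generic {A : Set} (O : Ops A) where
  open Ops O

  sumUpTo : ℕ → (ℕ → A) → A
  sumUpTo zero    f = 𝟘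
  sumUpTo (suc n) f = sumUpTo n f ⊕ f n

  prodUpTo : ℕ → (ℕ → A) → A
  prodUpTo zero    f = 𝟙
  prodUpTo (suc n) f = prodUpTo n f ⊗ f n

  pow : A → ℕ → A
  pow x zero    = 𝟙
  pow x (suc n) = pow x n ⊗ x

PSOps : {A : Set} → Ops A → Ops (ℕ → A)
PSOps {A} O = record
  { 𝟘 = λ _ → 𝟘
  ; 𝟙 = λ n → if n ≡ᵇ 0 then 𝟙 else 𝟘
  ; _⊕_ = λ f g n → f n ⊕ g n
  ; _⊗_ = λ f g n → sumUpTo (suc n) (λ i → f i ⊗ g (n ∸ i))
  ; ⊖_ = λ f n → ⊖ f n
  }
  where open Ops O
        open Generic O

-- Inverse of a power series f with constant coefficient 1:
-- the geometric series Σ_j (1 - f)^j, whose coefficient of x^a only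
-- involves j ≤ a since 1 - f has zero constant term.
inv1 : {A : Set} → Ops A → (ℕ → A) → (ℕ → A)
inv1 O f a = Generic.sumUpTo O (suc a)
               (λ j → Generic.pow (PSOps O) (Ops._⊕_ (PSOps O) (Ops.𝟙 (PSOps O)) (Ops.⊖_ (PSOps O) f)) j a)

-- B = ℚ[[Y]], Y = Y₀, Y₁, Y₂, … a sequence of indeterminates.
-- Monomials Y₀^e₀ Y₁^e₁ ⋯ (finitely many eᵢ ≠ 0) are coded by positive
-- integers via unique factorisation: Y₀^e₀ Y₁^e₁ ⋯ ↦ 2^e₀ 3^e₁ 5^e₂ ⋯.
-- Monomial multiplication becomes integer multiplication and the
-- monomial divisors of a monomial are exactly the integer divisors.
-- An element of B is a coefficient function; index y : ℕ stands for the
-- monomial coded by the integer y + 1.  The product is the Dirichlet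
-- convolution.

B : Set
B = ℕ → ℚ

BOps : Ops B
BOps = record
  { 𝟘 = λ _ → 0ℚ
  ; 𝟙 = λ y → if y ≡ᵇ 0 then 1ℚ else 0ℚ
  ; _⊕_ = λ f g y → f y Q.+ g y
  ; _⊗_ = λ f g y → Generic.sumUpTo ℚOps (suc y)
            (λ i → if does (suc i ∣? suc y)
                     then f i Q.* g ((suc y / suc i) ∸ 1)
                     else 0ℚ)
  ; ⊖_ = λ f y → Q.- f y
  }
  where
  ℚOps : Ops ℚ
  ℚOps = record { 𝟘 = 0ℚ ; 𝟙 = 1ℚ ; _⊕_ = Q._+_ ; _⊗_ = Q._*_ ; ⊖_ = Q.-_ }

-- R = B[[q]]   (index: exponent of q)
R : Set
R = ℕ → B

ROps : Ops R
ROps = PSOps BOps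

-- S = B[[q]][[t]] = B[[q,t]]   (index: exponent of t)
S : Set
S = ℕ → R

SOps : Ops S
SOps = PSOps ROps

module RR = Ops ROps
module SS = Ops SOps
module RG = Generic ROps
module SG = Generic SOps

-- coefficient of t^n q^a Y^(monomial coded by y+1) of H : S is  H n a y

constS : R → S
constS c n = if n ≡ᵇ 0 then c else RR.𝟘

tS : S
tS n = if n ≡ᵇ 1 then RR.𝟙 else RR.𝟘

ψ : ℕ → R
ψ m a = if a ≡ᵇ m then Ops.𝟙 BOps else Ops.𝟘 BOps

qint : ℕ → ℕ → R
qint m n = RG.sumUpTo n (λ i → RG.pow (ψ m) i)

qfact : ℕ → ℕ → R
qfact m n = RG.prodUpTo n (λ i → qint m (suc i))

scale : R → S → S
scale c H n = RR._⊗_ (RG.pow c n) (H n)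

-- H(t)/t for H with zero constant term in t
divT : S → S
divT H n = H (suc n)

-- D_ψ H(t) = (H(ψ t) - H(t)) / ((ψ - 1) t) = (H(t) - H(ψ t)) / ((1 - ψ) t);
-- 1 - ψ has constant q-coefficient 1 (m ≥ 1), so it is a unit of B[[q]].
Dψ : ℕ → S → S
Dψ m H = SS._⊗_ (divT (SS._⊕_ H (SS.⊖_ (scale (ψ m) H))))
                (constS (inv1 BOps (RR._⊕_ RR.𝟙 (RR.⊖_ (ψ m)))))

_≈S_ : S → S → Set
H ≈S K = ∀ n a y → H n a y ≡ K n a y

NoConst : S → Set
NoConst H = ∀ a y → H 0 a y ≡ 0ℚ

-- P k = F^{[k]_ψ} : defining property of the ψ-divided powers of F
IsDivPowers : ℕ → S → (ℕ → S) → Set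
IsDivPowers m F P =
  (P 0 ≈S SS.𝟙) ×
  (∀ k → NoConst (P (suc k)) ×
         (Dψ m (P (suc k)) ≈S
            SS._⊗_ (SS._⊗_ (constS (qint m (suc k))) (P k)) (Dψ m F)))

-- partial sums Σ_{k<N} F^{[k]_ψ} / [k]_ψ!  of  e_ψ[F]_ψ
-- ([k]_ψ! has constant q-coefficient 1, hence is a unit of B[[q]])
expPartial : ℕ → (ℕ → S) → ℕ → S
expPartial m P N =
  SG.sumUpTo N (λ k → SS._⊗_ (P k) (constS (inv1 BOps (qfact m k))))

factor : ℕ → S → ℕ → S
factor m F k =
  SS._⊕_ SS.𝟙
    (SS.⊖_ (SS._⊗_ (constS (RR._⊕_ RR.𝟙 (RR.⊖_ (ψ m))))
                   (scale (RG.pow (ψ m) k) (SS._⊗_ tS (Dψ m F)))))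

prodPartial : ℕ → S → ℕ → S
prodPartial m F N = SG.prodUpTo N (λ k → inv1 ROps (factor m F k))

Converges : (ℕ → S) → S → Set
Converges seq G =
  ∀ n a → ∃ λ N₀ → ∀ N → N₀ ≤ N → ∀ y → seq N n a y ≡ G n a y

module Submission where

-- All rings involved (B = ℚ[[Y]], B[[q]], B[[q,t]]) are convolution rings, in which a
-- series with constant term 1 is a unit.  On coefficients, D_ψ(Σ hₙ tⁿ) = Σ [n+1]_ψ hₙ₊₁ tⁿ,
-- and since ψ = q^m with m ≥ 1 every [n+1]_ψ and [n]_ψ! is a unit of B[[q]].  Hence the
-- ψ-divided powers exist (integrate coefficientwise), F^{[k]_ψ} has t-order ≥ k, and the
-- partial sums of G = e_ψ[F]_ψ stabilise coefficientwise.  Differentiating termwise gives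
-- D_ψ G = G · D_ψ F, which is the ψ-difference equation G(ψt) = φ(t) G(t) for
-- φ(t) = 1 − (1−ψ) t D_ψF(t).  Iterating, Π_{k<N} φ(ψᵏt) · G(t) = G(ψᴺt) ≡ 1 modulo q^N,
-- so the partial products Π_{k<N} φ(ψᵏt)⁻¹ agree with G modulo q^N.

open import Defs
open import Data.Nat using (ℕ; zero; suc; _+_; _*_; _∸_; _≤_; _<_; _≡ᵇ_; z≤n; s≤s)
import Data.Nat.Properties as ℕ
open import Data.Nat.Divisibility using (_∣_; _∣?_; divides)
open import Data.Nat.DivMod using (_/_; m*n/n≡m)
open import Data.Bool using (Bool; true; false; if_then_else_)
open import Data.Sum using (inj₁; inj₂)
open import Data.Product using (Σ; _×_; _,_; proj₁; proj₂)
open import Data.Empty using (⊥-elim)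
open import Data.Rational using (ℚ; 0ℚ; 1ℚ)
import Data.Rational as Q
import Data.Rational.Properties as Q
open import Relation.Nullary using (¬_; Dec; yes; no; does)
open import Relation.Nullary.Decidable using (dec-true; dec-false)
open import Relation.Binary.PropositionalEquality as ≡ using (_≡_)
open import Relation.Binary.Definitions using (tri<; tri≈; tri>)
open import Relation.Binary.Bundles using (Setoid)
open import Algebra.Bundles using (CommutativeRing)
open import Algebra.Structures using (IsCommutativeRing)
open import Level using (0ℓ)

record CommutativeRingOn (A : Set) : Set₁ where
  field
    ops : Ops A
    _≈_ : A → A → Set
    isCommutativeRing : IsCommutativeRing _≈_ (Ops._⊕_ ops) (Ops._⊗_ ops) (Ops.⊖_ ops) (Ops.𝟘 ops) (Ops.𝟙 ops)

  commutativeRing : CommutativeRing 0ℓ 0ℓ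
  commutativeRing = record { isCommutativeRing = isCommutativeRing }

≡ᵇ-≡ : ∀ {a b} → a ≡ b → (a ≡ᵇ b) ≡ true
≡ᵇ-≡ {a} {b} = dec-true (a ℕ.≟ b)

≡ᵇ-≢ : ∀ {a b} → ¬ a ≡ b → (a ≡ᵇ b) ≡ false
≡ᵇ-≢ {a} {b} = dec-false (a ℕ.≟ b)

module RingTheory {A : Set} (C : CommutativeRingOn A) where
  open CommutativeRingOn C using (ops; commutativeRing)
  open CommutativeRing commutativeRing public
    renaming (_+_ to infixl 6 _⊕_; _*_ to infixl 7 _⊗_; -_ to infix 8 ⊖_; 0# to 𝟘; 1# to 𝟙)
  open Generic ops public
  open import Algebra.Properties.Ring ring public using (-‿distribʳ-*)
  open import Algebra.Properties.AbelianGroup +-abelianGroup public using (⁻¹-∙-comm)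
  open import Algebra.Properties.Group +-group public using (ε⁻¹≈ε; ⁻¹-involutive; x∙y⁻¹≈ε⇒x≈y)
  open import Algebra.Properties.CommutativeSemigroup +-commutativeSemigroup public
    using () renaming (interchange to +-interchange)
  open import Algebra.Properties.CommutativeSemigroup *-commutativeSemigroup public
    using () renaming (interchange to *-interchange)
  open import Relation.Binary.Reasoning.Setoid setoid public
  open import Algebra.Solver.CommutativeMonoid *-commutativeMonoid public
    using (solve; _⊜_) renaming (_⊕_ to _·_)

  sum-cong-< : ∀ n {f g : ℕ → A} → (∀ i → i < n → f i ≈ g i) → sumUpTo n f ≈ sumUpTo n g
  sum-cong-< zero    f≈g = refl
  sum-cong-< (suc n) f≈g = +-cong (sum-cong-< n (λ i i<n → f≈g i (ℕ.m<n⇒m<1+n i<n))) (f≈g n ℕ.≤-refl)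

  sum-cong : ∀ n {f g : ℕ → A} → (∀ i → f i ≈ g i) → sumUpTo n f ≈ sumUpTo n g
  sum-cong n f≈g = sum-cong-< n (λ i _ → f≈g i)

  sum-zero : ∀ n {f : ℕ → A} → (∀ i → i < n → f i ≈ 𝟘) → sumUpTo n f ≈ 𝟘
  sum-zero zero    f≈0 = refl
  sum-zero (suc n) f≈0 =
    trans (+-cong (sum-zero n (λ i i<n → f≈0 i (ℕ.m<n⇒m<1+n i<n))) (f≈0 n ℕ.≤-refl)) (+-identityˡ 𝟘)

  sum-distrib-⊕ : ∀ n (f g : ℕ → A) → sumUpTo n (λ i → f i ⊕ g i) ≈ sumUpTo n f ⊕ sumUpTo n g
  sum-distrib-⊕ zero    f g = sym (+-identityˡ 𝟘)
  sum-distrib-⊕ (suc n) f g = trans (+-congʳ (sum-distrib-⊕ n f g)) (+-interchange _ _ _ _)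

  ⊗-distribˡ-sum : ∀ n x (f : ℕ → A) → x ⊗ sumUpTo n f ≈ sumUpTo n (λ i → x ⊗ f i)
  ⊗-distribˡ-sum zero    x f = zeroʳ x
  ⊗-distribˡ-sum (suc n) x f = trans (distribˡ x _ _) (+-congʳ (⊗-distribˡ-sum n x f))

  ⊗-distribʳ-sum : ∀ n x (f : ℕ → A) → sumUpTo n f ⊗ x ≈ sumUpTo n (λ i → f i ⊗ x)
  ⊗-distribʳ-sum zero    x f = zeroˡ x
  ⊗-distribʳ-sum (suc n) x f = trans (distribʳ x _ _) (+-congʳ (⊗-distribʳ-sum n x f))

  sum-unfoldˡ : ∀ n (f : ℕ → A) → sumUpTo (suc n) f ≈ f 0 ⊕ sumUpTo n (λ i → f (suc i))
  sum-unfoldˡ zero    f = trans (+-identityˡ _) (sym (+-identityʳ _))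
  sum-unfoldˡ (suc n) f = trans (+-congʳ (sum-unfoldˡ n f)) (+-assoc _ _ _)

  sum-comm : ∀ n k (f : ℕ → ℕ → A) →
    sumUpTo n (λ i → sumUpTo k (f i)) ≈ sumUpTo k (λ j → sumUpTo n (λ i → f i j))
  sum-comm zero    k f = sym (sum-zero k (λ _ _ → refl))
  sum-comm (suc n) k f = trans (+-congʳ (sum-comm n k f)) (sym (sum-distrib-⊕ k _ _))

  sum-single : ∀ n d (f : ℕ → A) → d < n → (∀ i → i < n → ¬ i ≡ d → f i ≈ 𝟘) → sumUpTo n f ≈ f d
  sum-single (suc n) d f d<1+n f≈0 with ℕ.m≤n⇒m<n∨m≡n (ℕ.≤-pred d<1+n)
  ... | inj₁ d<n = trans (+-cong (sum-single n d f d<n (λ i i<n → f≈0 i (ℕ.m<n⇒m<1+n i<n)))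
                                 (f≈0 n ℕ.≤-refl (λ n≡d → ℕ.<-irrefl (≡.sym n≡d) d<n)))
                         (+-identityʳ _)
  ... | inj₂ ≡.refl = trans (+-congʳ (sum-zero n (λ i i<n → f≈0 i (ℕ.m<n⇒m<1+n i<n) (ℕ.<⇒≢ i<n))))
                            (+-identityˡ _)

  sum-extend : ∀ M N (f : ℕ → A) → M ≤ N → (∀ i → M ≤ i → i < N → f i ≈ 𝟘) → sumUpTo M f ≈ sumUpTo N f
  sum-extend M zero    f M≤N f≈0 with ℕ.n≤0⇒n≡0 M≤N
  ... | ≡.refl = refl
  sum-extend M (suc N) f M≤N f≈0 with ℕ.m≤n⇒m<n∨m≡n M≤N
  ... | inj₂ ≡.refl = refl
  ... | inj₁ M<1+N  = trans (sum-extend M N f (ℕ.≤-pred M<1+N) (λ i M≤i i<N → f≈0 i M≤i (ℕ.m<n⇒m<1+n i<N)))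
                            (trans (sym (+-identityʳ _)) (+-congˡ (sym (f≈0 N (ℕ.≤-pred M<1+N) ℕ.≤-refl))))

  when : Bool → A → A
  when b x = if b then x else 𝟘

  when-cong : ∀ b {x y} → x ≈ y → when b x ≈ when b y
  when-cong true  x≈y = x≈y
  when-cong false x≈y = refl

  when-𝟘 : ∀ b → when b 𝟘 ≈ 𝟘
  when-𝟘 true  = refl
  when-𝟘 false = refl

  when-⊕ : ∀ b x y → when b (x ⊕ y) ≈ when b x ⊕ when b y
  when-⊕ true  x y = refl
  when-⊕ false x y = sym (+-identityˡ 𝟘)

  when-⊗ˡ : ∀ b x y → when b x ⊗ y ≈ when b (x ⊗ y)
  when-⊗ˡ true  x y = refl
  when-⊗ˡ false x y = zeroˡ y

  when-⊗ʳ : ∀ b x y → x ⊗ when b y ≈ when b (x ⊗ y)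
  when-⊗ʳ true  x y = refl
  when-⊗ʳ false x y = zeroʳ x

  when-sum : ∀ b n (f : ℕ → A) → when b (sumUpTo n f) ≈ sumUpTo n (λ i → when b (f i))
  when-sum true  n f = refl
  when-sum false n f = sym (sum-zero n (λ _ _ → refl))

  when-≡ : ∀ {a b} (x : A) → a ≡ b → when (a ≡ᵇ b) x ≈ x
  when-≡ x a≡b rewrite ≡ᵇ-≡ a≡b = refl

  when-≢ : ∀ {a b} (x : A) → ¬ a ≡ b → when (a ≡ᵇ b) x ≈ 𝟘
  when-≢ x a≢b rewrite ≡ᵇ-≢ a≢b = refl

  inverse-unique : ∀ {a b x} → a ⊗ x ≈ 𝟙 → b ⊗ x ≈ 𝟙 → a ≈ b
  inverse-unique {a} {b} {x} ax≈1 bx≈1 = begin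
    a           ≈⟨ sym (*-identityʳ a) ⟩
    a ⊗ 𝟙       ≈⟨ *-congˡ (sym bx≈1) ⟩
    a ⊗ (b ⊗ x) ≈⟨ solve 3 (λ a b x → a · (b · x) ⊜ (a · x) · b) refl a b x ⟩
    (a ⊗ x) ⊗ b ≈⟨ *-congʳ ax≈1 ⟩
    𝟙 ⊗ b       ≈⟨ *-identityˡ b ⟩
    b           ∎

  unit-cancelˡ : ∀ {a x} y → a ⊗ x ≈ 𝟙 → x ⊗ (a ⊗ y) ≈ y
  unit-cancelˡ {a} {x} y ax≈1 = begin
    x ⊗ (a ⊗ y) ≈⟨ solve 3 (λ a x y → x · (a · y) ⊜ (a · x) · y) refl a x y ⟩
    (a ⊗ x) ⊗ y ≈⟨ *-congʳ ax≈1 ⟩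
    𝟙 ⊗ y       ≈⟨ *-identityˡ y ⟩
    y           ∎

  unit⊗y≈𝟘⇒y≈𝟘 : ∀ {a x y} → a ⊗ x ≈ 𝟙 → x ⊗ y ≈ 𝟘 → y ≈ 𝟘
  unit⊗y≈𝟘⇒y≈𝟘 {a} {x} {y} ax≈1 xy≈0 = begin
    y           ≈⟨ sym (unit-cancelˡ y ax≈1) ⟩
    x ⊗ (a ⊗ y) ≈⟨ solve 3 (λ a x y → x · (a · y) ⊜ a · (x · y)) refl a x y ⟩
    a ⊗ (x ⊗ y) ≈⟨ *-congˡ xy≈0 ⟩
    a ⊗ 𝟘       ≈⟨ zeroʳ a ⟩
    𝟘           ∎

  x≈y⇒x⊖y≈𝟘 : ∀ {x y} → x ≈ y → x ⊕ ⊖ y ≈ 𝟘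
  x≈y⇒x⊖y≈𝟘 {x} {y} x≈y = trans (+-congʳ x≈y) (-‿inverseʳ y)

  x⊖𝟘≈x : ∀ x → x ⊕ ⊖ 𝟘 ≈ x
  x⊖𝟘≈x x = trans (+-congˡ ε⁻¹≈ε) (+-identityʳ x)

  x⊖[x⊖y]≈y : ∀ x y → x ⊕ ⊖ (x ⊕ ⊖ y) ≈ y
  x⊖[x⊖y]≈y x y = begin
    x ⊕ ⊖ (x ⊕ ⊖ y)   ≈⟨ +-congˡ (sym (⁻¹-∙-comm x (⊖ y))) ⟩
    x ⊕ (⊖ x ⊕ ⊖ ⊖ y) ≈⟨ sym (+-assoc x (⊖ x) (⊖ ⊖ y)) ⟩
    (x ⊕ ⊖ x) ⊕ ⊖ ⊖ y ≈⟨ +-cong (-‿inverseʳ x) (⁻¹-involutive y) ⟩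
    𝟘 ⊕ y             ≈⟨ +-identityˡ y ⟩
    y                 ∎

  x⊗[y⊖z]≈x⊗y⊖x⊗z : ∀ x y z → x ⊗ (y ⊕ ⊖ z) ≈ x ⊗ y ⊕ ⊖ (x ⊗ z)
  x⊗[y⊖z]≈x⊗y⊖x⊗z x y z = trans (distribˡ x y (⊖ z)) (+-congˡ (sym (-‿distribʳ-* x z)))

  [𝟙⊖a]⊗x≈x⊖a⊗x : ∀ a x → (𝟙 ⊕ ⊖ a) ⊗ x ≈ x ⊕ ⊖ (a ⊗ x)
  [𝟙⊖a]⊗x≈x⊖a⊗x a x = begin
    (𝟙 ⊕ ⊖ a) ⊗ x       ≈⟨ *-comm _ x ⟩
    x ⊗ (𝟙 ⊕ ⊖ a)       ≈⟨ x⊗[y⊖z]≈x⊗y⊖x⊗z x 𝟙 a ⟩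
    x ⊗ 𝟙 ⊕ ⊖ (x ⊗ a)   ≈⟨ +-cong (*-identityʳ x) (-‿cong (*-comm x a)) ⟩
    x ⊕ ⊖ (a ⊗ x)       ∎

  geometric-sum : ∀ N x → sumUpTo N (pow x) ⊗ (𝟙 ⊕ ⊖ x) ≈ 𝟙 ⊕ ⊖ pow x N
  geometric-sum zero    x = trans (zeroˡ _) (sym (-‿inverseʳ 𝟙))
  geometric-sum (suc N) x = begin
    (sumUpTo N (pow x) ⊕ pow x N) ⊗ (𝟙 ⊕ ⊖ x)
      ≈⟨ distribʳ _ _ _ ⟩
    sumUpTo N (pow x) ⊗ (𝟙 ⊕ ⊖ x) ⊕ pow x N ⊗ (𝟙 ⊕ ⊖ x)
      ≈⟨ +-cong (geometric-sum N x) (trans (x⊗[y⊖z]≈x⊗y⊖x⊗z (pow x N) 𝟙 x) (+-congʳ (*-identityʳ _))) ⟩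
    (𝟙 ⊕ ⊖ pow x N) ⊕ (pow x N ⊕ ⊖ pow x (suc N))
      ≈⟨ +-assoc 𝟙 _ _ ⟩
    𝟙 ⊕ (⊖ pow x N ⊕ (pow x N ⊕ ⊖ pow x (suc N)))
      ≈⟨ +-congˡ (trans (sym (+-assoc _ _ _)) (trans (+-congʳ (-‿inverseˡ _)) (+-identityˡ _))) ⟩
    𝟙 ⊕ ⊖ pow x (suc N) ∎

  pow-cong : ∀ n {x y} → x ≈ y → pow x n ≈ pow y n
  pow-cong zero    x≈y = refl
  pow-cong (suc n) x≈y = *-cong (pow-cong n x≈y) x≈y

  pow-+ : ∀ x i j → pow x i ⊗ pow x j ≈ pow x (i + j)
  pow-+ x i zero    = trans (*-identityʳ _) (reflexive (≡.cong (pow x) (≡.sym (ℕ.+-identityʳ i))))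
  pow-+ x i (suc j) = trans (sym (*-assoc _ _ _)) (trans (*-congʳ (pow-+ x i j))
                        (reflexive (≡.cong (pow x) (≡.sym (ℕ.+-suc i j)))))

  pow-distrib-⊗ : ∀ x y n → pow (x ⊗ y) n ≈ pow x n ⊗ pow y n
  pow-distrib-⊗ x y zero    = sym (*-identityˡ 𝟙)
  pow-distrib-⊗ x y (suc n) = trans (*-congʳ (pow-distrib-⊗ x y n)) (*-interchange _ _ _ _)

  pow-𝟙 : ∀ n → pow 𝟙 n ≈ 𝟙
  pow-𝟙 zero    = refl
  pow-𝟙 (suc n) = trans (*-identityʳ _) (pow-𝟙 n)

-- Convolution rings

module Pointwise {A : Set} (C : CommutativeRingOn A) where
  open RingTheory C

  _≈ᵖ_ : (ℕ → A) → (ℕ → A) → Set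
  f ≈ᵖ g = ∀ n → f n ≈ g n

  _⊕ᵖ_ : (ℕ → A) → (ℕ → A) → (ℕ → A)
  (f ⊕ᵖ g) n = f n ⊕ g n

  ⊖ᵖ_ : (ℕ → A) → (ℕ → A)
  (⊖ᵖ f) n = ⊖ f n

  𝟘ᵖ 𝟙ᵖ : ℕ → A
  𝟘ᵖ _ = 𝟘
  𝟙ᵖ n = if n ≡ᵇ 0 then 𝟙 else 𝟘

  setoidᵖ : Setoid _ _
  setoidᵖ = record
    { Carrier = ℕ → A ; _≈_ = _≈ᵖ_
    ; isEquivalence = record { refl = λ n → refl ; sym = λ e n → sym (e n) ; trans = λ e e′ n → trans (e n) (e′ n) } }

  open import Algebra.Structures _≈ᵖ_ using (IsAbelianGroup)
  open import Algebra.Definitions _≈ᵖ_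
  open import Algebra.Consequences.Setoid setoidᵖ using (comm∧idˡ⇒id; comm∧distrˡ⇒distr)

  isAbelianGroupᵖ : IsAbelianGroup _⊕ᵖ_ 𝟘ᵖ ⊖ᵖ_
  isAbelianGroupᵖ = record
    { isGroup = record
      { isMonoid = record
        { isSemigroup = record
          { isMagma = record
            { isEquivalence = Setoid.isEquivalence setoidᵖ
            ; ∙-cong = λ e e′ n → +-cong (e n) (e′ n) }
          ; assoc = λ f g h n → +-assoc (f n) (g n) (h n) }
        ; identity = (λ f n → +-identityˡ (f n)) , (λ f n → +-identityʳ (f n)) }
      ; inverse = (λ f n → -‿inverseˡ (f n)) , (λ f n → -‿inverseʳ (f n))
      ; ⁻¹-cong = λ e n → -‿cong (e n) }
    ; comm = λ f g n → +-comm (f n) (g n) }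

  -- The laws are proved for a reference multiplication [conv] and carried over
  -- to a pointwise-equal one, which is the form in which Defs gives the product.
  isCommutativeRingᵖ :
    (mul conv : (ℕ → A) → (ℕ → A) → (ℕ → A)) → (∀ f g → mul f g ≈ᵖ conv f g) →
    Congruent₂ conv → Associative conv → LeftIdentity 𝟙ᵖ conv →
    conv DistributesOverˡ _⊕ᵖ_ → Commutative conv →
    IsCommutativeRing _≈ᵖ_ _⊕ᵖ_ mul ⊖ᵖ_ 𝟘ᵖ 𝟙ᵖ
  isCommutativeRingᵖ mul conv mul≈conv cong assoc identityˡ distribˡ′ comm = record
    { isRing = record
      { +-isAbelianGroup = isAbelianGroupᵖ
      ; *-cong = mul-cong
      ; *-assoc = λ f g h → ≈ᵖ-trans (mul≈conv (mul f g) h)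
                     (≈ᵖ-trans (cong (mul≈conv f g) ≈ᵖ-refl)
                     (≈ᵖ-trans (assoc f g h)
                     (≈ᵖ-trans (cong ≈ᵖ-refl (≈ᵖ-sym (mul≈conv g h)))
                               (≈ᵖ-sym (mul≈conv f (mul g h))))))
      ; *-identity = comm∧idˡ⇒id mul-comm (λ f → ≈ᵖ-trans (mul≈conv 𝟙ᵖ f) (identityˡ f))
      ; distrib = comm∧distrˡ⇒distr (λ e e′ n → +-cong (e n) (e′ n)) mul-comm
          (λ f g h n → trans (mul≈conv f (g ⊕ᵖ h) n)
                       (trans (distribˡ′ f g h n) (sym (+-cong (mul≈conv f g n) (mul≈conv f h n))))) }
    ; *-comm = mul-comm }
    where
    open Setoid setoidᵖ using () renaming (refl to ≈ᵖ-refl; trans to ≈ᵖ-trans; sym to ≈ᵖ-sym)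
    mul-cong : Congruent₂ mul
    mul-cong {f} {g} {u} {v} f≈g u≈v =
      ≈ᵖ-trans (mul≈conv f u) (≈ᵖ-trans (cong f≈g u≈v) (≈ᵖ-sym (mul≈conv g v)))
    mul-comm : Commutative mul
    mul-comm f g = ≈ᵖ-trans (mul≈conv f g) (≈ᵖ-trans (comm f g) (≈ᵖ-sym (mul≈conv g f)))

-- Summing over i, j ≤ n in degree n loses nothing because i ≤ μ i j.
module Convolution {A : Set} (C : CommutativeRingOn A) (μ : ℕ → ℕ → ℕ)
    (μ-comm : ∀ i j → μ i j ≡ μ j i)
    (μ-assoc : ∀ i j k → μ (μ i j) k ≡ μ i (μ j k))
    (μ-identityˡ : ∀ j → μ 0 j ≡ j)
    (μ-≥ˡ : ∀ i j → i ≤ μ i j) where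
  open RingTheory C
  open Pointwise C

  convUpTo : ℕ → (ℕ → A) → (ℕ → A) → ℕ → A
  convUpTo N f g n = sumUpTo N (λ i → sumUpTo N (λ j → when (μ i j ≡ᵇ n) (f i ⊗ g j)))

  conv : (ℕ → A) → (ℕ → A) → (ℕ → A)
  conv f g n = convUpTo (suc n) f g n

  μ≡⇒≤ˡ : ∀ {i j n} → μ i j ≡ n → i ≤ n
  μ≡⇒≤ˡ {i} {j} ≡.refl = μ-≥ˡ i j

  μ≡⇒≤ʳ : ∀ {i j n} → μ i j ≡ n → j ≤ n
  μ≡⇒≤ʳ {i} {j} μij≡n = μ≡⇒≤ˡ (≡.trans (μ-comm j i) μij≡n)

  conv≈convUpTo : ∀ N n f g → n < N → conv f g n ≈ convUpTo N f g n
  conv≈convUpTo N n f g n<N =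
    trans (sum-cong (suc n) (λ i → sum-extend (suc n) N _ n<N
              (λ j n<j _ → when-≢ _ (λ e → ℕ.<⇒≱ n<j (μ≡⇒≤ʳ e)))))
          (sum-extend (suc n) N _ n<N
              (λ i n<i _ → sum-zero N (λ j _ → when-≢ _ (λ e → ℕ.<⇒≱ n<i (μ≡⇒≤ˡ e)))))

  conv-cong : ∀ {f f′ g g′} → f ≈ᵖ f′ → g ≈ᵖ g′ → conv f g ≈ᵖ conv f′ g′
  conv-cong f≈ g≈ n = sum-cong (suc n) (λ i → sum-cong (suc n) (λ j → when-cong _ (*-cong (f≈ i) (g≈ j))))

  conv-comm : ∀ f g → conv f g ≈ᵖ conv g f
  conv-comm f g n = trans (sum-comm (suc n) (suc n) _)
    (sum-cong (suc n) (λ i → sum-cong (suc n) (λ j →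
       trans (reflexive (≡.cong (λ b → when b (f j ⊗ g i)) (≡.cong (_≡ᵇ n) (μ-comm j i))))
             (when-cong _ (*-comm (f j) (g i))))))

  conv-identityˡ : ∀ g → conv 𝟙ᵖ g ≈ᵖ g
  conv-identityˡ g n = trans (sum-single (suc n) 0 _ (s≤s z≤n)
      (λ { zero _ 0≢0 → ⊥-elim (0≢0 ≡.refl)
         ; (suc i) _ _ → sum-zero (suc n) (λ j _ → trans (when-cong _ (zeroˡ (g j))) (when-𝟘 _)) }))
    (trans (sum-single (suc n) n _ ℕ.≤-refl
              (λ j _ j≢n → when-≢ _ (λ e → j≢n (≡.trans (≡.sym (μ-identityˡ j)) e))))
           (trans (when-≡ _ (μ-identityˡ n)) (*-identityˡ (g n))))

  conv-distribˡ : ∀ f g h → conv f (g ⊕ᵖ h) ≈ᵖ (conv f g ⊕ᵖ conv f h)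
  conv-distribˡ f g h n = trans (sum-cong (suc n) (λ i → trans (sum-cong (suc n) (λ j →
        trans (when-cong _ (distribˡ (f i) (g j) (h j))) (when-⊕ _ _ _))) (sum-distrib-⊕ (suc n) _ _)))
     (sum-distrib-⊕ (suc n) _ _)

  when-when-≢ : ∀ b {d c} (x : A) → ¬ d ≡ c → when b (when (d ≡ᵇ c) x) ≈ 𝟘
  when-when-≢ b x d≢c = trans (when-cong b (when-≢ x d≢c)) (when-𝟘 b)

  sum-collapse : ∀ n d k (x : A) →
    sumUpTo (suc n) (λ c → when (μ c k ≡ᵇ n) (when (d ≡ᵇ c) x)) ≈ when (μ d k ≡ᵇ n) x
  sum-collapse n d k x with ℕ.<-cmp d (suc n)
  ... | tri< d≤n _ _ =
    trans (sum-single (suc n) d _ d≤n (λ c _ c≢d → when-when-≢ (μ c k ≡ᵇ n) x (λ d≡c → c≢d (≡.sym d≡c))))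
          (when-cong (μ d k ≡ᵇ n) (when-≡ {d} {d} x ≡.refl))
  ... | tri≈ _ ≡.refl _ =
    trans (sum-zero (suc n) (λ c c≤n → when-when-≢ (μ c k ≡ᵇ n) x (λ d≡c → ℕ.<-irrefl (≡.sym d≡c) c≤n)))
          (sym (when-≢ {μ d k} {n} x (λ e → ℕ.<-irrefl ≡.refl (s≤s (μ≡⇒≤ˡ e)))))
  ... | tri> _ _ n<d =
    trans (sum-zero (suc n) (λ c c≤n → when-when-≢ (μ c k ≡ᵇ n) x (λ d≡c → ℕ.<-irrefl (≡.sym d≡c) (ℕ.<-trans c≤n n<d))))
          (sym (when-≢ {μ d k} {n} x (λ e → ℕ.<⇒≱ n<d (ℕ.m≤n⇒m≤1+n (μ≡⇒≤ˡ e)))))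

  module _ (f g h : ℕ → A) (n : ℕ) where
    private
      N = suc n

      triple : (ℕ → ℕ → ℕ → A) → A
      triple x = sumUpTo N (λ i → sumUpTo N (λ j → sumUpTo N (λ k → x i j k)))

    conv-expandˡ : conv (conv f g) h n ≈ triple (λ i j k → when (μ (μ i j) k ≡ᵇ n) ((f i ⊗ g j) ⊗ h k))
    conv-expandˡ = begin
      conv (conv f g) h n
        ≈⟨ sum-cong-< N (λ c c<N → sum-cong N (λ k → inner c k c<N)) ⟩
      sumUpTo N (λ c → sumUpTo N (λ k → sumUpTo N (λ i → sumUpTo N (λ j → x c k i j))))
        ≈⟨ sum-cong N (λ c → sum-comm N N _) ⟩
      sumUpTo N (λ c → sumUpTo N (λ i → sumUpTo N (λ k → sumUpTo N (λ j → x c k i j))))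
        ≈⟨ sum-cong N (λ c → sum-cong N (λ i → sum-comm N N _)) ⟩
      sumUpTo N (λ c → triple (λ i j k → x c k i j))
        ≈⟨ sum-comm N N _ ⟩
      sumUpTo N (λ i → sumUpTo N (λ c → sumUpTo N (λ j → sumUpTo N (λ k → x c k i j))))
        ≈⟨ sum-cong N (λ i → sum-comm N N _) ⟩
      sumUpTo N (λ i → sumUpTo N (λ j → sumUpTo N (λ c → sumUpTo N (λ k → x c k i j))))
        ≈⟨ sum-cong N (λ i → sum-cong N (λ j → sum-comm N N _)) ⟩
      triple (λ i j k → sumUpTo N (λ c → x c k i j))
        ≈⟨ sum-cong N (λ i → sum-cong N (λ j → sum-cong N (λ k → sum-collapse n (μ i j) k _))) ⟩
      triple (λ i j k → when (μ (μ i j) k ≡ᵇ n) ((f i ⊗ g j) ⊗ h k)) ∎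
      where
      x : ℕ → ℕ → ℕ → ℕ → A
      x c k i j = when (μ c k ≡ᵇ n) (when (μ i j ≡ᵇ c) ((f i ⊗ g j) ⊗ h k))
      inner : ∀ c k → c < N → when (μ c k ≡ᵇ n) (conv f g c ⊗ h k) ≈ sumUpTo N (λ i → sumUpTo N (λ j → x c k i j))
      inner c k c<N = begin
        when (μ c k ≡ᵇ n) (conv f g c ⊗ h k)
          ≈⟨ when-cong (μ c k ≡ᵇ n) (*-congʳ (conv≈convUpTo N c f g c<N)) ⟩
        when (μ c k ≡ᵇ n) (convUpTo N f g c ⊗ h k)
          ≈⟨ when-cong (μ c k ≡ᵇ n) (trans (⊗-distribʳ-sum N (h k) _) (sum-cong N (λ i →
               trans (⊗-distribʳ-sum N (h k) _) (sum-cong N (λ j → when-⊗ˡ (μ i j ≡ᵇ c) _ _))))) ⟩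
        when (μ c k ≡ᵇ n) (sumUpTo N (λ i → sumUpTo N (λ j → when (μ i j ≡ᵇ c) ((f i ⊗ g j) ⊗ h k))))
          ≈⟨ trans (when-sum (μ c k ≡ᵇ n) N _) (sum-cong N (λ i → when-sum (μ c k ≡ᵇ n) N _)) ⟩
        sumUpTo N (λ i → sumUpTo N (λ j → x c k i j)) ∎

    conv-expandʳ : conv f (conv g h) n ≈ triple (λ i j k → when (μ (μ i j) k ≡ᵇ n) (f i ⊗ (g j ⊗ h k)))
    conv-expandʳ = begin
      conv f (conv g h) n
        ≈⟨ sum-cong N (λ i → sum-cong-< N (λ c c<N → inner i c c<N)) ⟩
      sumUpTo N (λ i → sumUpTo N (λ c → sumUpTo N (λ j → sumUpTo N (λ k → z i c j k))))
        ≈⟨ sum-cong N (λ i → sum-comm N N _) ⟩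
      sumUpTo N (λ i → sumUpTo N (λ j → sumUpTo N (λ c → sumUpTo N (λ k → z i c j k))))
        ≈⟨ sum-cong N (λ i → sum-cong N (λ j → sum-comm N N _)) ⟩
      triple (λ i j k → sumUpTo N (λ c → z i c j k))
        ≈⟨ sum-cong N (λ i → sum-cong N (λ j → sum-cong N (λ k → trans (sum-collapse n (μ j k) i _)
              (reflexive (≡.cong (λ b → when b (f i ⊗ (g j ⊗ h k))) (≡.cong (_≡ᵇ n)
                 (≡.trans (μ-comm (μ j k) i) (≡.sym (μ-assoc i j k))))))))) ⟩
      triple (λ i j k → when (μ (μ i j) k ≡ᵇ n) (f i ⊗ (g j ⊗ h k))) ∎
      where
      z : ℕ → ℕ → ℕ → ℕ → A
      z i c j k = when (μ c i ≡ᵇ n) (when (μ j k ≡ᵇ c) (f i ⊗ (g j ⊗ h k)))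
      inner : ∀ i c → c < N → when (μ i c ≡ᵇ n) (f i ⊗ conv g h c) ≈ sumUpTo N (λ j → sumUpTo N (λ k → z i c j k))
      inner i c c<N = begin
        when (μ i c ≡ᵇ n) (f i ⊗ conv g h c)
          ≈⟨ reflexive (≡.cong (λ b → when b (f i ⊗ conv g h c)) (≡.cong (_≡ᵇ n) (μ-comm i c))) ⟩
        when (μ c i ≡ᵇ n) (f i ⊗ conv g h c)
          ≈⟨ when-cong (μ c i ≡ᵇ n) (*-congˡ (conv≈convUpTo N c g h c<N)) ⟩
        when (μ c i ≡ᵇ n) (f i ⊗ convUpTo N g h c)
          ≈⟨ when-cong (μ c i ≡ᵇ n) (trans (⊗-distribˡ-sum N (f i) _) (sum-cong N (λ j →
               trans (⊗-distribˡ-sum N (f i) _) (sum-cong N (λ k → when-⊗ʳ (μ j k ≡ᵇ c) _ _))))) ⟩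
        when (μ c i ≡ᵇ n) (sumUpTo N (λ j → sumUpTo N (λ k → when (μ j k ≡ᵇ c) (f i ⊗ (g j ⊗ h k)))))
          ≈⟨ trans (when-sum (μ c i ≡ᵇ n) N _) (sum-cong N (λ j → when-sum (μ c i ≡ᵇ n) N _)) ⟩
        sumUpTo N (λ j → sumUpTo N (λ k → z i c j k)) ∎

    conv-assoc : conv (conv f g) h n ≈ conv f (conv g h) n
    conv-assoc = trans conv-expandˡ (trans (sum-cong N (λ i → sum-cong N (λ j → sum-cong N (λ k →
                   when-cong (μ (μ i j) k ≡ᵇ n) (*-assoc (f i) (g j) (h k)))))) (sym conv-expandʳ))

  isCommutativeRing-conv : (mul : (ℕ → A) → (ℕ → A) → (ℕ → A)) → (∀ f g → mul f g ≈ᵖ conv f g) →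
    IsCommutativeRing _≈ᵖ_ _⊕ᵖ_ mul ⊖ᵖ_ 𝟘ᵖ 𝟙ᵖ
  isCommutativeRing-conv mul mul≈conv =
    isCommutativeRingᵖ mul conv mul≈conv (λ {f} {f′} {g} {g′} → conv-cong {f} {f′} {g} {g′})
      (λ f g h n → conv-assoc f g h n) conv-identityˡ conv-distribˡ conv-comm

powerSeriesRing : {A : Set} → CommutativeRingOn A → CommutativeRingOn (ℕ → A)
powerSeriesRing {A} C = record
  { ops = PSOps ops
  ; _≈_ = _≈ᵖ_
  ; isCommutativeRing = isCommutativeRing-conv (Ops._⊗_ (PSOps ops)) ps≈conv }
  where
  open CommutativeRingOn C using (ops)
  open RingTheory C
  open Pointwise C
  open Convolution C _+_ ℕ.+-comm ℕ.+-assoc (λ _ → ≡.refl) ℕ.m≤m+n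
  ps≈conv : ∀ f g → Ops._⊗_ (PSOps ops) f g ≈ᵖ conv f g
  ps≈conv f g n = sym (sum-cong-< (suc n) (λ i i≤n →
    trans (sum-single (suc n) (n ∸ i) _ (s≤s (ℕ.m∸n≤m n i))
             (λ j _ j≢n∸i → when-≢ _ (λ i+j≡n →
                j≢n∸i (≡.subst (λ x → j ≡ x ∸ i) i+j≡n (≡.sym (ℕ.m+n∸m≡n i j))))))
          (when-≡ _ (ℕ.m+[n∸m]≡n (ℕ.≤-pred i≤n)))))

ℚ-ring : CommutativeRingOn ℚ
ℚ-ring = record
  { ops = record { 𝟘 = 0ℚ ; 𝟙 = 1ℚ ; _⊕_ = Q._+_ ; _⊗_ = Q._*_ ; ⊖_ = Q.-_ }
  ; _≈_ = _≡_
  ; isCommutativeRing = Q.+-*-isCommutativeRing }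

-- The divisor sum of BOps is the convolution for μ i j = (i+1)(j+1) − 1.
B-ring : CommutativeRingOn B
B-ring = record { ops = BOps ; _≈_ = _≈ᵖ_ ; isCommutativeRing = isCommutativeRing-conv (Ops._⊗_ BOps) B≈conv }
  where
  open RingTheory ℚ-ring
  open Pointwise ℚ-ring

  μ : ℕ → ℕ → ℕ
  μ i j = suc i * suc j ∸ 1

  open Convolution ℚ-ring μ (λ i j → ≡.cong (_∸ 1) (ℕ.*-comm (suc i) (suc j)))
                            (λ i j k → ≡.cong (_∸ 1) (ℕ.*-assoc (suc i) (suc j) (suc k)))
                            ℕ.+-identityʳ (λ i j → ℕ.≤-pred (ℕ.m≤m*n (suc i) (suc j)))

  divisor-term : ∀ (f g : B) y i (d? : Dec (suc i ∣ suc y)) →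
    (if does d? then f i Q.* g ((suc y / suc i) ∸ 1) else 0ℚ)
      ≡ sumUpTo (suc y) (λ j → when (μ i j ≡ᵇ y) (f i Q.* g j))
  divisor-term f g y i (no i∤y) = sym (sum-zero (suc y) (λ j _ → when-≢ _ (λ μij≡y → i∤y (divides (suc j)
      (≡.trans (≡.cong suc (≡.sym μij≡y)) (ℕ.*-comm (suc i) (suc j)))))))
  divisor-term f g y i (yes (divides zero 1+y≡0)) = ⊥-elim (ℕ.0≢1+n (≡.sym 1+y≡0))
  divisor-term f g y i (yes (divides (suc k) 1+y≡[1+k][1+i])) = sym (trans
      (sum-single (suc y) k _ k<1+y (λ j _ j≢k → when-≢ _ (λ μij≡y → j≢k (ℕ.suc-injective
         (ℕ.*-cancelˡ-≡ (suc j) (suc k) (suc i)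
           (≡.trans (≡.cong suc μij≡y) (≡.trans 1+y≡[1+k][1+i] (ℕ.*-comm (suc k) (suc i)))))))))
      (trans (when-≡ _ (ℕ.suc-injective (≡.trans (ℕ.*-comm (suc i) (suc k)) (≡.sym 1+y≡[1+k][1+i]))))
             (≡.cong (λ x → f i Q.* g x) (≡.sym quotient))))
    where
    quotient : (suc y / suc i) ∸ 1 ≡ k
    quotient = ≡.cong (_∸ 1) (≡.trans (≡.cong (_/ suc i) 1+y≡[1+k][1+i]) (m*n/n≡m (suc k) (suc i)))
    k<1+y : k < suc y
    k<1+y = s≤s (ℕ.≤-pred (≡.subst (suc k ≤_) (≡.sym 1+y≡[1+k][1+i]) (ℕ.m≤m*n (suc k) (suc i))))

  B≈conv : ∀ f g → Ops._⊗_ BOps f g ≈ᵖ conv f g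
  B≈conv f g y = sum-cong (suc y) (λ i → divisor-term f g y i (suc i ∣? suc y))

R-ring : CommutativeRingOn R
R-ring = powerSeriesRing B-ring

S-ring : CommutativeRingOn S
S-ring = powerSeriesRing R-ring

-- Power series: order, dilation, inverses

module PowerSeries {A : Set} (C : CommutativeRingOn A) where
  module a = RingTheory C
  module p = RingTheory (powerSeriesRing C)
  open a using (_≈_; _⊕_; _⊗_; ⊖_; 𝟘; 𝟙; sumUpTo; pow)
  open CommutativeRingOn C using (ops)

  Series : Set
  Series = ℕ → A

  Order≥ : ℕ → Series → Set
  Order≥ k f = ∀ n → n < k → f n ≈ 𝟘

  order≥-cong : ∀ {k f g} → f p.≈ g → Order≥ k f → Order≥ k g
  order≥-cong f≈g f≥k n n<k = a.trans (a.sym (f≈g n)) (f≥k n n<k)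

  order≥-weaken : ∀ {k k′ f} → k ≤ k′ → Order≥ k′ f → Order≥ k f
  order≥-weaken k≤k′ f≥k′ n n<k = f≥k′ n (ℕ.<-≤-trans n<k k≤k′)

  order≥-⊕ : ∀ {k f g} → Order≥ k f → Order≥ k g → Order≥ k (f p.⊕ g)
  order≥-⊕ f≥k g≥k n n<k = a.trans (a.+-cong (f≥k n n<k) (g≥k n n<k)) (a.+-identityˡ 𝟘)

  order≥-⊖ : ∀ {k f} → Order≥ k f → Order≥ k (p.⊖ f)
  order≥-⊖ f≥k n n<k = a.trans (a.-‿cong (f≥k n n<k)) a.ε⁻¹≈ε

  order≥-sum : ∀ {k} N (fs : ℕ → Series) → (∀ i → Order≥ k (fs i)) → Order≥ k (p.sumUpTo N fs)
  order≥-sum zero    fs fs≥k n n<k = a.refl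
  order≥-sum (suc N) fs fs≥k = order≥-⊕ (order≥-sum N fs fs≥k) (fs≥k N)

  order≥-⊗ : ∀ {i j f g} → Order≥ i f → Order≥ j g → Order≥ (i + j) (f p.⊗ g)
  order≥-⊗ {i} {j} {f} {g} f≥i g≥j n n<i+j = a.sum-zero (suc n) (λ l l<1+n → term l (ℕ.≤-pred l<1+n))
    where
    term : ∀ l → l ≤ n → f l ⊗ g (n ∸ l) ≈ 𝟘
    term l l≤n with l ℕ.<? i
    ... | yes l<i = a.trans (a.*-congʳ (f≥i l l<i)) (a.zeroˡ _)
    ... | no l≮i = a.trans (a.*-congˡ (g≥j (n ∸ l) n∸l<j)) (a.zeroʳ _)
      where
      n∸l<j : n ∸ l < j
      n∸l<j = ≡.subst (n ∸ l <_) (ℕ.m+n∸m≡n l j)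
                (ℕ.∸-monoˡ-< (ℕ.<-≤-trans n<i+j (ℕ.+-monoˡ-≤ j (ℕ.≮⇒≥ l≮i))) l≤n)

  order≥-⊗ˡ : ∀ {i f g} → Order≥ i f → Order≥ i (f p.⊗ g)
  order≥-⊗ˡ {i} {f} {g} f≥i n n<i =
    order≥-⊗ {i} {0} {f} {g} f≥i (λ _ ()) n (≡.subst (n <_) (≡.sym (ℕ.+-identityʳ i)) n<i)

  order≥-⊗ʳ : ∀ {j f g} → Order≥ j g → Order≥ j (f p.⊗ g)
  order≥-⊗ʳ {j} {f} {g} = order≥-⊗ {0} {j} {f} {g} (λ _ ())

  order≥-pow : ∀ {k x} j → Order≥ k x → Order≥ (j * k) (p.pow x j)
  order≥-pow zero    x≥k n ()
  order≥-pow {k} {x} (suc j) x≥k = ≡.subst (λ e → Order≥ e (p.pow x (suc j))) (ℕ.+-comm (j * k) k)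
    (order≥-⊗ {j * k} {k} {p.pow x j} {x} (order≥-pow j x≥k) x≥k)

  coeff-sum : ∀ N (fs : ℕ → Series) n → p.sumUpTo N fs n ≈ sumUpTo N (λ i → fs i n)
  coeff-sum zero    fs n = a.refl
  coeff-sum (suc N) fs n = a.+-congʳ (coeff-sum N fs n)

  coeff₀-⊗ : ∀ f g → (f p.⊗ g) 0 ≈ f 0 ⊗ g 0
  coeff₀-⊗ f g = a.+-identityˡ _

  coeff-⊗-congˡ : ∀ n f f′ g → (∀ i → i ≤ n → f i ≈ f′ i) → (f p.⊗ g) n ≈ (f′ p.⊗ g) n
  coeff-⊗-congˡ n f f′ g f≈f′ = a.sum-cong-< (suc n) (λ i i<1+n → a.*-congʳ (f≈f′ i (ℕ.≤-pred i<1+n)))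

  const : A → Series
  const c n = if n ≡ᵇ 0 then c else 𝟘

  const-cong : ∀ {c d} → c ≈ d → const c p.≈ const d
  const-cong c≈d zero    = c≈d
  const-cong c≈d (suc n) = a.refl

  const-⊗ˡ : ∀ c H → (const c p.⊗ H) p.≈ (λ n → c ⊗ H n)
  const-⊗ˡ c H n = a.trans (a.sum-unfoldˡ n _)
    (a.trans (a.+-congˡ (a.sum-zero n (λ i _ → a.zeroˡ _))) (a.+-identityʳ _))

  const-⊗ʳ : ∀ c H → (H p.⊗ const c) p.≈ (λ n → H n ⊗ c)
  const-⊗ʳ c H n = a.trans (p.*-comm H (const c) n) (a.trans (const-⊗ˡ c H n) (a.*-comm c (H n)))

  const-⊗-const : ∀ c d → const c p.⊗ const d p.≈ const (c ⊗ d)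
  const-⊗-const c d zero    = const-⊗ˡ c (const d) zero
  const-⊗-const c d (suc n) = a.trans (const-⊗ˡ c (const d) (suc n)) (a.zeroʳ c)

  t : Series
  t n = if n ≡ᵇ 1 then 𝟙 else 𝟘

  order≥-t : Order≥ 1 t
  order≥-t zero    _ = a.refl
  order≥-t (suc n) (s≤s ())

  coeff-suc-t⊗ : ∀ H n → (t p.⊗ H) (suc n) ≈ H n
  coeff-suc-t⊗ H n = a.trans
    (a.sum-single (suc (suc n)) 1 _ (s≤s (s≤s z≤n))
      (λ { zero _ _ → a.zeroˡ _ ; (suc zero) _ 1≢1 → ⊥-elim (1≢1 ≡.refl) ; (suc (suc i)) _ _ → a.zeroˡ _ }))
    (a.*-identityˡ (H n))

  dilate : A → Series → Series
  dilate c H n = pow c n ⊗ H n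

  dilate-cong : ∀ {c d H K} → c ≈ d → H p.≈ K → dilate c H p.≈ dilate d K
  dilate-cong c≈d H≈K n = a.*-cong (a.pow-cong n c≈d) (H≈K n)

  dilate-⊕ : ∀ c H K → dilate c (H p.⊕ K) p.≈ (dilate c H p.⊕ dilate c K)
  dilate-⊕ c H K n = a.distribˡ _ _ _

  dilate-⊖ : ∀ c H → dilate c (p.⊖ H) p.≈ p.⊖ dilate c H
  dilate-⊖ c H n = a.sym (a.-‿distribʳ-* _ _)

  dilate-by-𝟙 : ∀ H → dilate 𝟙 H p.≈ H
  dilate-by-𝟙 H n = a.trans (a.*-congʳ (a.pow-𝟙 n)) (a.*-identityˡ (H n))

  dilate-const : ∀ c d → dilate c (const d) p.≈ const d
  dilate-const c d zero    = a.*-identityˡ d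
  dilate-const c d (suc n) = a.zeroʳ _

  dilate-dilate : ∀ c d H → dilate c (dilate d H) p.≈ dilate (c ⊗ d) H
  dilate-dilate c d H n = a.trans (a.sym (a.*-assoc _ _ _)) (a.*-congʳ (a.sym (a.pow-distrib-⊗ c d n)))

  dilate-⊗ : ∀ c H K → dilate c (H p.⊗ K) p.≈ (dilate c H p.⊗ dilate c K)
  dilate-⊗ c H K n = a.trans (a.⊗-distribˡ-sum (suc n) _ _) (a.sum-cong-< (suc n) (λ i i<1+n → begin
      pow c n ⊗ (H i ⊗ K (n ∸ i))
        ≈⟨ a.*-congʳ (a.sym (a.trans (a.pow-+ c i (n ∸ i))
             (a.reflexive (≡.cong (pow c) (ℕ.m+[n∸m]≡n (ℕ.≤-pred i<1+n)))))) ⟩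
      (pow c i ⊗ pow c (n ∸ i)) ⊗ (H i ⊗ K (n ∸ i))
        ≈⟨ a.*-interchange _ _ _ _ ⟩
      (pow c i ⊗ H i) ⊗ (pow c (n ∸ i) ⊗ K (n ∸ i)) ∎))
    where open a using (begin_; step-≈-⟩; _∎)

  order≥-dilate : ∀ {k} c H → Order≥ k H → Order≥ k (dilate c H)
  order≥-dilate c H H≥k n n<k = a.trans (a.*-congˡ (H≥k n n<k)) (a.zeroʳ _)

  -- inv1 f = Σ_j g^j with g = 1 − f of order ≥ 1, so up to degree n it agrees
  -- with the partial geometric sum Σ_{j ≤ n} g^j.
  inv1-inverse : ∀ f → f 0 ≈ 𝟙 → inv1 ops f p.⊗ f p.≈ p.𝟙
  inv1-inverse f f₀≈1 n = begin
    (inv1 ops f p.⊗ f) n                    ≈⟨ coeff-⊗-congˡ n _ (partial (suc n)) f inv1≈partial ⟩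
    (partial (suc n) p.⊗ f) n               ≈⟨ p.*-congˡ {partial (suc n)} (p.sym (p.x⊖[x⊖y]≈y p.𝟙 f)) n ⟩
    (partial (suc n) p.⊗ (p.𝟙 p.⊕ p.⊖ g)) n ≈⟨ p.geometric-sum (suc n) g n ⟩
    p.𝟙 n ⊕ ⊖ p.pow g (suc n) n             ≈⟨ a.+-congˡ (a.-‿cong (g^j≥j (suc n) n ℕ.≤-refl)) ⟩
    p.𝟙 n ⊕ ⊖ 𝟘                             ≈⟨ a.x⊖𝟘≈x _ ⟩
    p.𝟙 n                                   ∎
    where
    open a using (begin_; step-≈-⟩; _∎)
    g : Series
    g = p.𝟙 p.⊕ p.⊖ f
    g^j≥j : ∀ j → Order≥ j (p.pow g j)
    g^j≥j j = ≡.subst (λ e → Order≥ e (p.pow g j)) (ℕ.*-identityʳ j)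
      (order≥-pow j (λ { zero _ → a.x≈y⇒x⊖y≈𝟘 (a.sym f₀≈1) ; (suc _) (s≤s ()) }))
    partial : ℕ → Series
    partial N = p.sumUpTo N (p.pow g)
    inv1≈partial : ∀ i → i ≤ n → inv1 ops f i ≈ partial (suc n) i
    inv1≈partial i i≤n = a.trans (a.sum-extend (suc i) (suc n) _ (s≤s i≤n) (λ j i<j _ → g^j≥j j i i<j))
                                 (a.sym (coeff-sum (suc n) (p.pow g) i))

-- The ψ-calculus

-- QS: series in q over B;  TS: series in t over B[[q]].
module b = RingTheory B-ring
module r = RingTheory R-ring
module s = RingTheory S-ring
module QS = PowerSeries B-ring
module TS = PowerSeries R-ring

module QCalculus (m : ℕ) (1≤m : 1 ≤ m) where
  ψ≥1 : QS.Order≥ 1 (ψ m)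
  ψ≥1 zero    _ = b.when-≢ b.𝟙 (ℕ.<⇒≢ 1≤m)
  ψ≥1 (suc n) (s≤s ())

  ψ^N≥N : ∀ N → QS.Order≥ N (r.pow (ψ m) N)
  ψ^N≥N N = ≡.subst (λ e → QS.Order≥ e (r.pow (ψ m) N)) (ℕ.*-identityʳ N) (QS.order≥-pow N ψ≥1)

  1-ψ : R
  1-ψ = r.𝟙 r.⊕ r.⊖ ψ m

  1-ψ-invertible : inv1 BOps 1-ψ r.⊗ 1-ψ r.≈ r.𝟙
  1-ψ-invertible = QS.inv1-inverse 1-ψ 1-ψ₀≈1
    where
    1-ψ₀≈1 : 1-ψ 0 b.≈ b.𝟙
    1-ψ₀≈1 = b.trans (b.+-congˡ {b.𝟙} (b.-‿cong {ψ m 0} {b.𝟘} (ψ≥1 0 (s≤s z≤n)))) (b.x⊖𝟘≈x b.𝟙)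

  [1+n]₀≈1 : ∀ n → qint m (suc n) 0 b.≈ b.𝟙
  [1+n]₀≈1 n = b.trans (QS.coeff-sum (suc n) (r.pow (ψ m)) 0)
    (b.trans (b.sum-unfoldˡ n _)
    (b.trans (b.+-congˡ {r.pow (ψ m) 0 0} (b.sum-zero n (λ i _ → ψ^N≥N (suc i) 0 (s≤s z≤n)))) (b.+-identityʳ b.𝟙)))

  [1+n]-invertible : ∀ n → inv1 BOps (qint m (suc n)) r.⊗ qint m (suc n) r.≈ r.𝟙
  [1+n]-invertible n = QS.inv1-inverse (qint m (suc n)) ([1+n]₀≈1 n)

  [n]!₀≈1 : ∀ n → qfact m n 0 b.≈ b.𝟙
  [n]!₀≈1 zero    = b.refl
  [n]!₀≈1 (suc n) = b.trans (QS.coeff₀-⊗ (qfact m n) (qint m (suc n)))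
    (b.trans (b.*-cong ([n]!₀≈1 n) ([1+n]₀≈1 n)) (b.*-identityˡ b.𝟙))

  [n]!-invertible : ∀ n → inv1 BOps (qfact m n) r.⊗ qfact m n r.≈ r.𝟙
  [n]!-invertible n = QS.inv1-inverse (qfact m n) ([n]!₀≈1 n)

  [1+n]⊗[n]!⁻¹≈[n]!⁻¹ : ∀ n → qint m (suc n) r.⊗ inv1 BOps (qfact m (suc n)) r.≈ inv1 BOps (qfact m n)
  [1+n]⊗[n]!⁻¹≈[n]!⁻¹ n = r.inverse-unique {x = qfact m n}
    (r.trans (r.solve 3 (λ a b c → (a r.· b) r.· c r.⊜ b r.· (c r.· a)) r.refl
               (qint m (suc n)) (inv1 BOps (qfact m (suc n))) (qfact m n))
             ([n]!-invertible (suc n)))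
    ([n]!-invertible n)

  1-ψ⊗[1+n]≈1-ψ^[1+n] : ∀ n → 1-ψ r.⊗ qint m (suc n) r.≈ r.𝟙 r.⊕ r.⊖ r.pow (ψ m) (suc n)
  1-ψ⊗[1+n]≈1-ψ^[1+n] n = r.trans (r.*-comm 1-ψ (qint m (suc n))) (r.geometric-sum (suc n) (ψ m))

  Dψ-coeff : ∀ H n → Dψ m H n r.≈ qint m (suc n) r.⊗ H (suc n)
  Dψ-coeff H n = begin
    Dψ m H n
      ≈⟨ TS.const-⊗ʳ (inv1 BOps 1-ψ) (divT (H s.⊕ s.⊖ scale (ψ m) H)) n ⟩
    (H (suc n) r.⊕ r.⊖ (ψ^[1+n] r.⊗ H (suc n))) r.⊗ inv1 BOps 1-ψ
      ≈⟨ r.*-congʳ {inv1 BOps 1-ψ} (r.sym (r.[𝟙⊖a]⊗x≈x⊖a⊗x ψ^[1+n] (H (suc n)))) ⟩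
    ((r.𝟙 r.⊕ r.⊖ ψ^[1+n]) r.⊗ H (suc n)) r.⊗ inv1 BOps 1-ψ
      ≈⟨ r.*-congʳ {inv1 BOps 1-ψ} (r.*-congʳ {H (suc n)} (r.sym (1-ψ⊗[1+n]≈1-ψ^[1+n] n))) ⟩
    ((1-ψ r.⊗ qint m (suc n)) r.⊗ H (suc n)) r.⊗ inv1 BOps 1-ψ
      ≈⟨ r.solve 4 (λ a b c d → ((a r.· b) r.· c) r.· d r.⊜ (b r.· c) r.· (d r.· a)) r.refl
           1-ψ (qint m (suc n)) (H (suc n)) (inv1 BOps 1-ψ) ⟩
    (qint m (suc n) r.⊗ H (suc n)) r.⊗ (inv1 BOps 1-ψ r.⊗ 1-ψ)
      ≈⟨ r.*-congˡ {qint m (suc n) r.⊗ H (suc n)} 1-ψ-invertible ⟩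
    (qint m (suc n) r.⊗ H (suc n)) r.⊗ r.𝟙
      ≈⟨ r.*-identityʳ _ ⟩
    qint m (suc n) r.⊗ H (suc n) ∎
    where
    open r using (begin_; step-≈-⟩; _∎)
    ψ^[1+n] = r.pow (ψ m) (suc n)

  Dψ-cong : ∀ {H K} → H s.≈ K → Dψ m H s.≈ Dψ m K
  Dψ-cong {H} {K} H≈K n =
    r.trans (Dψ-coeff H n) (r.trans (r.*-congˡ {qint m (suc n)} (H≈K (suc n))) (r.sym (Dψ-coeff K n)))

  Dψ-⊕ : ∀ H K → Dψ m (H s.⊕ K) s.≈ (Dψ m H s.⊕ Dψ m K)
  Dψ-⊕ H K n = r.trans (Dψ-coeff (H s.⊕ K) n) (r.trans (r.distribˡ (qint m (suc n)) (H (suc n)) (K (suc n)))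
                 (r.sym (r.+-cong (Dψ-coeff H n) (Dψ-coeff K n))))

  Dψ-const : ∀ c → Dψ m (constS c) s.≈ s.𝟘
  Dψ-const c n = r.trans (Dψ-coeff (constS c) n) (r.zeroʳ (qint m (suc n)))

  Dψ-sum : ∀ N (Hs : ℕ → S) → Dψ m (s.sumUpTo N Hs) s.≈ s.sumUpTo N (λ k → Dψ m (Hs k))
  Dψ-sum zero    Hs = Dψ-const r.𝟘
  Dψ-sum (suc N) Hs = s.trans (Dψ-⊕ (s.sumUpTo N Hs) (Hs N)) (s.+-congʳ {Dψ m (Hs N)} (Dψ-sum N Hs))

  Dψ-⊗-const : ∀ H c → Dψ m (H s.⊗ constS c) s.≈ (Dψ m H s.⊗ constS c)
  Dψ-⊗-const H c n = begin
    Dψ m (H s.⊗ constS c) n                     ≈⟨ Dψ-coeff (H s.⊗ constS c) n ⟩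
    qint m (suc n) r.⊗ (H s.⊗ constS c) (suc n) ≈⟨ r.*-congˡ {qint m (suc n)} (TS.const-⊗ʳ c H (suc n)) ⟩
    qint m (suc n) r.⊗ (H (suc n) r.⊗ c)        ≈⟨ r.sym (r.*-assoc (qint m (suc n)) (H (suc n)) c) ⟩
    (qint m (suc n) r.⊗ H (suc n)) r.⊗ c        ≈⟨ r.*-congʳ {c} (r.sym (Dψ-coeff H n)) ⟩
    Dψ m H n r.⊗ c                              ≈⟨ r.sym (TS.const-⊗ʳ c (Dψ m H) n) ⟩
    (Dψ m H s.⊗ constS c) n                     ∎
    where open r using (begin_; step-≈-⟩; _∎)

  integrate : S → S
  integrate H zero    = r.𝟘
  integrate H (suc n) = inv1 BOps (qint m (suc n)) r.⊗ H n

  Dψ-integrate : ∀ H → Dψ m (integrate H) s.≈ H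
  Dψ-integrate H n = r.trans (Dψ-coeff (integrate H) n)
    (r.unit-cancelˡ {inv1 BOps (qint m (suc n))} {qint m (suc n)} (H n) ([1+n]-invertible n))

  divPowers : S → ℕ → S
  divPowers F zero    = s.𝟙
  divPowers F (suc k) = integrate ((constS (qint m (suc k)) s.⊗ divPowers F k) s.⊗ Dψ m F)

  divPowers-isDivPowers : ∀ F → IsDivPowers m F (divPowers F)
  divPowers-isDivPowers F = (λ _ _ _ → ≡.refl) , (λ k → (λ _ _ → ≡.refl) , Dψ-integrate _)

  isDivPowers⇒order≥ : ∀ {F P} → IsDivPowers m F P → ∀ k → TS.Order≥ k (P k)
  isDivPowers⇒order≥ isDP zero n ()
  isDivPowers⇒order≥ {F} {P} isDP (suc k) zero _ = proj₁ (proj₂ isDP k)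
  isDivPowers⇒order≥ {F} {P} isDP (suc k) (suc n) (s≤s n<k) =
    r.unit⊗y≈𝟘⇒y≈𝟘 {inv1 BOps (qint m (suc n))} {qint m (suc n)} {P (suc k) (suc n)} ([1+n]-invertible n)
      (r.trans (r.sym (Dψ-coeff (P (suc k)) n)) (r.trans (proj₂ (proj₂ isDP k) n)
        (TS.order≥-⊗ˡ {k} {constS (qint m (suc k)) s.⊗ P k} {Dψ m F}
           (TS.order≥-⊗ʳ {k} {constS (qint m (suc k))} {P k} (isDivPowers⇒order≥ {F} {P} isDP k)) n n<k)))

  t-Dψ-difference : ∀ H → constS 1-ψ s.⊗ (tS s.⊗ Dψ m H) s.≈ H s.⊕ s.⊖ scale (ψ m) H
  t-Dψ-difference H zero = begin
    (constS 1-ψ s.⊗ (tS s.⊗ Dψ m H)) 0 ≈⟨ TS.const-⊗ˡ 1-ψ (tS s.⊗ Dψ m H) 0 ⟩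
    1-ψ r.⊗ (tS s.⊗ Dψ m H) 0          ≈⟨ r.*-congˡ {1-ψ} (TS.order≥-⊗ˡ {1} {tS} {Dψ m H} TS.order≥-t 0 (s≤s z≤n)) ⟩
    1-ψ r.⊗ r.𝟘                        ≈⟨ r.zeroʳ 1-ψ ⟩
    r.𝟘                                ≈⟨ r.sym (r.x≈y⇒x⊖y≈𝟘 (r.sym (r.*-identityˡ (H 0)))) ⟩
    H 0 r.⊕ r.⊖ (r.𝟙 r.⊗ H 0)          ∎
    where open r using (begin_; step-≈-⟩; _∎)
  t-Dψ-difference H (suc n) = begin
    (constS 1-ψ s.⊗ (tS s.⊗ Dψ m H)) (suc n)         ≈⟨ TS.const-⊗ˡ 1-ψ (tS s.⊗ Dψ m H) (suc n) ⟩
    1-ψ r.⊗ (tS s.⊗ Dψ m H) (suc n)                  ≈⟨ r.*-congˡ {1-ψ} (TS.coeff-suc-t⊗ (Dψ m H) n) ⟩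
    1-ψ r.⊗ Dψ m H n                                 ≈⟨ r.*-congˡ {1-ψ} (Dψ-coeff H n) ⟩
    1-ψ r.⊗ (qint m (suc n) r.⊗ H (suc n))           ≈⟨ r.sym (r.*-assoc 1-ψ (qint m (suc n)) (H (suc n))) ⟩
    (1-ψ r.⊗ qint m (suc n)) r.⊗ H (suc n)           ≈⟨ r.*-congʳ {H (suc n)} (1-ψ⊗[1+n]≈1-ψ^[1+n] n) ⟩
    (r.𝟙 r.⊕ r.⊖ r.pow (ψ m) (suc n)) r.⊗ H (suc n) ≈⟨ r.[𝟙⊖a]⊗x≈x⊖a⊗x (r.pow (ψ m) (suc n)) (H (suc n)) ⟩
    (H s.⊕ s.⊖ scale (ψ m) H) (suc n)                ∎
    where open r using (begin_; step-≈-⟩; _∎)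

  module ProductFormula (F : S) (G : S) (G₀≈1 : G 0 r.≈ r.𝟙) (Dψ-G : Dψ m G s.≈ G s.⊗ Dψ m F) where
    ψ^ : ℕ → R
    ψ^ = r.pow (ψ m)

    tDψF : S
    tDψF = tS s.⊗ Dψ m F

    factor-dilate : ∀ k → factor m F k s.≈ scale (ψ^ k) (factor m F 0)
    factor-dilate k = s.sym (begin
      scale c (s.𝟙 s.⊕ s.⊖ y)
        ≈⟨ TS.dilate-⊕ c s.𝟙 (s.⊖ y) ⟩
      scale c s.𝟙 s.⊕ scale c (s.⊖ y)
        ≈⟨ s.+-cong (TS.dilate-const c r.𝟙) (TS.dilate-⊖ c y) ⟩
      s.𝟙 s.⊕ s.⊖ scale c y
        ≈⟨ s.+-congˡ {s.𝟙} (s.-‿cong (TS.dilate-⊗ c (constS 1-ψ) (scale r.𝟙 tDψF))) ⟩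
      s.𝟙 s.⊕ s.⊖ (scale c (constS 1-ψ) s.⊗ scale c (scale r.𝟙 tDψF))
        ≈⟨ s.+-congˡ {s.𝟙} (s.-‿cong (s.*-cong (TS.dilate-const c 1-ψ) (TS.dilate-dilate c r.𝟙 tDψF))) ⟩
      s.𝟙 s.⊕ s.⊖ (constS 1-ψ s.⊗ scale (c r.⊗ r.𝟙) tDψF)
        ≈⟨ s.+-congˡ {s.𝟙} (s.-‿cong (s.*-congˡ {constS 1-ψ}
             (TS.dilate-cong {c r.⊗ r.𝟙} {c} {tDψF} (r.*-identityʳ c) s.refl))) ⟩
      factor m F k ∎)
      where
      open s using (begin_; step-≈-⟩; _∎)
      c = ψ^ k
      y = constS 1-ψ s.⊗ scale r.𝟙 tDψF

    factor₀⊗G≈Gψ : factor m F 0 s.⊗ G s.≈ scale (ψ m) G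
    factor₀⊗G≈Gψ = begin
      (s.𝟙 s.⊕ s.⊖ y) s.⊗ G               ≈⟨ s.[𝟙⊖a]⊗x≈x⊖a⊗x y G ⟩
      G s.⊕ s.⊖ (y s.⊗ G)                 ≈⟨ s.+-congˡ {G} (s.-‿cong y⊗G≈G⊖Gψ) ⟩
      G s.⊕ s.⊖ (G s.⊕ s.⊖ scale (ψ m) G) ≈⟨ s.x⊖[x⊖y]≈y G (scale (ψ m) G) ⟩
      scale (ψ m) G                       ∎
      where
      open s using (begin_; step-≈-⟩; _∎)
      y = constS 1-ψ s.⊗ scale r.𝟙 tDψF
      y⊗G≈G⊖Gψ : y s.⊗ G s.≈ G s.⊕ s.⊖ scale (ψ m) G
      y⊗G≈G⊖Gψ = begin
        (constS 1-ψ s.⊗ scale r.𝟙 tDψF) s.⊗ G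
          ≈⟨ s.*-congʳ {G} (s.*-congˡ {constS 1-ψ} (TS.dilate-by-𝟙 tDψF)) ⟩
        (constS 1-ψ s.⊗ (tS s.⊗ Dψ m F)) s.⊗ G
          ≈⟨ s.solve 4 (λ a b d e → (a s.· (b s.· d)) s.· e s.⊜ a s.· (b s.· (e s.· d)))
               s.refl (constS 1-ψ) tS (Dψ m F) G ⟩
        constS 1-ψ s.⊗ (tS s.⊗ (G s.⊗ Dψ m F))
          ≈⟨ s.*-congˡ {constS 1-ψ} (s.*-congˡ {tS} (s.sym Dψ-G)) ⟩
        constS 1-ψ s.⊗ (tS s.⊗ Dψ m G)
          ≈⟨ t-Dψ-difference G ⟩
        G s.⊕ s.⊖ scale (ψ m) G ∎

    factor⊗Gψ^k≈Gψ^[1+k] : ∀ k → factor m F k s.⊗ scale (ψ^ k) G s.≈ scale (ψ^ (suc k)) G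
    factor⊗Gψ^k≈Gψ^[1+k] k = begin
      factor m F k s.⊗ scale c G                 ≈⟨ s.*-congʳ {scale c G} (factor-dilate k) ⟩
      scale c (factor m F 0) s.⊗ scale c G       ≈⟨ s.sym (TS.dilate-⊗ c (factor m F 0) G) ⟩
      scale c (factor m F 0 s.⊗ G)               ≈⟨ TS.dilate-cong {c} {c} r.refl factor₀⊗G≈Gψ ⟩
      scale c (scale (ψ m) G)                    ≈⟨ TS.dilate-dilate c (ψ m) G ⟩
      scale (ψ^ (suc k)) G                       ∎
      where
      open s using (begin_; step-≈-⟩; _∎)
      c = ψ^ k

    Π : ℕ → S
    Π N = s.prodUpTo N (factor m F)

    Π⊗G≈Gψ^N : ∀ N → Π N s.⊗ G s.≈ scale (ψ^ N) G
    Π⊗G≈Gψ^N zero    = s.trans (s.*-identityˡ G) (s.sym (TS.dilate-by-𝟙 G))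
    Π⊗G≈Gψ^N (suc N) = begin
      (Π N s.⊗ factor m F N) s.⊗ G
        ≈⟨ s.solve 3 (λ a b d → (a s.· b) s.· d s.⊜ b s.· (a s.· d)) s.refl (Π N) (factor m F N) G ⟩
      factor m F N s.⊗ (Π N s.⊗ G)    ≈⟨ s.*-congˡ {factor m F N} (Π⊗G≈Gψ^N N) ⟩
      factor m F N s.⊗ scale (ψ^ N) G ≈⟨ factor⊗Gψ^k≈Gψ^[1+k] N ⟩
      scale (ψ^ (suc N)) G            ∎
      where open s using (begin_; step-≈-⟩; _∎)

    factor₀≈1 : ∀ k → factor m F k 0 r.≈ r.𝟙
    factor₀≈1 k = r.trans (r.+-congˡ {r.𝟙} (r.-‿cong {y 0} {r.𝟘} y₀≈0)) (r.x⊖𝟘≈x r.𝟙)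
      where
      y = constS 1-ψ s.⊗ scale (ψ^ k) tDψF
      y₀≈0 : y 0 r.≈ r.𝟘
      y₀≈0 = TS.order≥-⊗ʳ {1} {constS 1-ψ} {scale (ψ^ k) tDψF}
               (TS.order≥-dilate (ψ^ k) tDψF (TS.order≥-⊗ˡ {1} {tS} {Dψ m F} TS.order≥-t)) 0 (s≤s z≤n)

    prodPartial⊗Π≈1 : ∀ N → prodPartial m F N s.⊗ Π N s.≈ s.𝟙
    prodPartial⊗Π≈1 zero    = s.*-identityˡ s.𝟙
    prodPartial⊗Π≈1 (suc N) = begin
      (prodPartial m F N s.⊗ inv1 ROps (factor m F N)) s.⊗ (Π N s.⊗ factor m F N)
        ≈⟨ s.*-interchange (prodPartial m F N) (inv1 ROps (factor m F N)) (Π N) (factor m F N) ⟩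
      (prodPartial m F N s.⊗ Π N) s.⊗ (inv1 ROps (factor m F N) s.⊗ factor m F N)
        ≈⟨ s.*-cong (prodPartial⊗Π≈1 N) (TS.inv1-inverse (factor m F N) (factor₀≈1 N)) ⟩
      s.𝟙 s.⊗ s.𝟙
        ≈⟨ s.*-identityˡ s.𝟙 ⟩
      s.𝟙 ∎
      where open s using (begin_; step-≈-⟩; _∎)

    G⊖prodPartial : ∀ N → G s.⊕ s.⊖ prodPartial m F N s.≈ prodPartial m F N s.⊗ (scale (ψ^ N) G s.⊕ s.⊖ s.𝟙)
    G⊖prodPartial N = s.sym (begin
      Q s.⊗ (scale (ψ^ N) G s.⊕ s.⊖ s.𝟙)       ≈⟨ s.x⊗[y⊖z]≈x⊗y⊖x⊗z Q (scale (ψ^ N) G) s.𝟙 ⟩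
      Q s.⊗ scale (ψ^ N) G s.⊕ s.⊖ (Q s.⊗ s.𝟙) ≈⟨ s.+-cong Q⊗Gψ^N≈G (s.-‿cong (s.*-identityʳ Q)) ⟩
      G s.⊕ s.⊖ Q                              ∎)
      where
      open s using (begin_; step-≈-⟩; _∎)
      Q = prodPartial m F N
      Q⊗Gψ^N≈G : Q s.⊗ scale (ψ^ N) G s.≈ G
      Q⊗Gψ^N≈G = begin
        Q s.⊗ scale (ψ^ N) G ≈⟨ s.*-congˡ {Q} (s.sym (Π⊗G≈Gψ^N N)) ⟩
        Q s.⊗ (Π N s.⊗ G)    ≈⟨ s.sym (s.*-assoc Q (Π N) G) ⟩
        (Q s.⊗ Π N) s.⊗ G    ≈⟨ s.*-congʳ {G} (prodPartial⊗Π≈1 N) ⟩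
        s.𝟙 s.⊗ G            ≈⟨ s.*-identityˡ G ⟩
        G                    ∎

    Gψ^N⊖1-order≥ : ∀ N n → QS.Order≥ N ((scale (ψ^ N) G s.⊕ s.⊖ s.𝟙) n)
    Gψ^N⊖1-order≥ N zero a _ = r.x≈y⇒x⊖y≈𝟘 {r.𝟙 r.⊗ G 0} {r.𝟙} (r.trans (r.*-identityˡ (G 0)) G₀≈1) a
    Gψ^N⊖1-order≥ N (suc n) = QS.order≥-⊕ {N} {r.pow (ψ^ N) (suc n) r.⊗ G (suc n)} {r.⊖ r.𝟘}
      (QS.order≥-⊗ˡ {N} {r.pow (ψ^ N) (suc n)} {G (suc n)}
         (QS.order≥-weaken {N} {suc n * N} (ℕ.m≤m+n N (n * N)) (QS.order≥-pow (suc n) (ψ^N≥N N))))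
      (QS.order≥-⊖ {N} {r.𝟘} (λ _ _ → b.refl))

    G⊖prodPartial-order≥ : ∀ N n → QS.Order≥ N ((G s.⊕ s.⊖ prodPartial m F N) n)
    G⊖prodPartial-order≥ N n = QS.order≥-cong {N} {(Q s.⊗ Z) n} (r.sym (G⊖prodPartial N n))
      (QS.order≥-sum (suc n) (λ i → Q i r.⊗ Z (n ∸ i))
         (λ i → QS.order≥-⊗ʳ {N} {Q i} {Z (n ∸ i)} (Gψ^N⊖1-order≥ N (n ∸ i))))
      where
      Q = prodPartial m F N
      Z = scale (ψ^ N) G s.⊕ s.⊖ s.𝟙

    prodPartial⟶G : Converges (prodPartial m F) G
    prodPartial⟶G n a = suc a , λ N a<N y →
      ≡.sym (ℚᵣ.x∙y⁻¹≈ε⇒x≈y (G n a y) (prodPartial m F N n a y) (G⊖prodPartial-order≥ N n a a<N y))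
      where module ℚᵣ = RingTheory ℚ-ring

  module Exponential (F : S) (P : ℕ → S) (isDP : IsDivPowers m F P) where
    term : ℕ → S
    term k = P k s.⊗ constS (inv1 BOps (qfact m k))

    -- term k has t-order ≥ k, so the coefficient of tⁿ is final once N > n.
    E : S
    E n = expPartial m P (suc n) n

    term-order≥ : ∀ k → TS.Order≥ k (term k)
    term-order≥ k = TS.order≥-⊗ˡ {k} {P k} {constS (inv1 BOps (qfact m k))} (isDivPowers⇒order≥ {F} {P} isDP k)

    expPartial-stable : ∀ n k → expPartial m P (k + suc n) n r.≈ E n
    expPartial-stable n zero    = r.refl
    expPartial-stable n (suc k) = r.trans {expPartial m P (suc k + suc n) n} {E n r.⊕ r.𝟘}
      (r.+-cong {expPartial m P (k + suc n) n} {E n} {term (k + suc n) n} {r.𝟘}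
        (expPartial-stable n k) (term-order≥ (k + suc n) n (ℕ.m≤n+m (suc n) k)))
      (r.+-identityʳ (E n))

    expPartial⟶E : Converges (expPartial m P) E
    expPartial⟶E n a = suc n , λ N n<N y →
      ≡.subst (λ N → expPartial m P N n a y ≡ E n a y) (ℕ.m∸n+n≡m n<N) (expPartial-stable n (N ∸ suc n) a y)

    E₀≈1 : E 0 r.≈ r.𝟙
    E₀≈1 = begin
      r.𝟘 r.⊕ term 0 0                ≈⟨ r.+-identityˡ (term 0 0) ⟩
      term 0 0                        ≈⟨ TS.const-⊗ʳ (inv1 BOps (qfact m 0)) (P 0) 0 ⟩
      P 0 0 r.⊗ inv1 BOps (qfact m 0) ≈⟨ r.*-cong {P 0 0} {r.𝟙} (proj₁ isDP 0) [0]!⁻¹≈1 ⟩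
      r.𝟙 r.⊗ r.𝟙                     ≈⟨ r.*-identityˡ r.𝟙 ⟩
      r.𝟙                             ∎
      where
      open r using (begin_; step-≈-⟩; _∎)
      [0]!⁻¹≈1 : inv1 BOps (qfact m 0) r.≈ r.𝟙
      [0]!⁻¹≈1 = r.inverse-unique {inv1 BOps (qfact m 0)} {r.𝟙} {r.𝟙} ([n]!-invertible 0) (r.*-identityˡ r.𝟙)

    E⊖1-noConst : NoConst (SS._⊕_ E (SS.⊖_ SS.𝟙))
    E⊖1-noConst a y = r.x≈y⇒x⊖y≈𝟘 {E 0} {r.𝟙} E₀≈1 a y

    Dψ-term-zero : Dψ m (term 0) s.≈ s.𝟘
    Dψ-term-zero = s.trans (Dψ-⊗-const (P 0) c)
      (s.trans (s.*-congʳ {constS c} (s.trans (Dψ-cong (proj₁ isDP)) (Dψ-const r.𝟙))) (s.zeroˡ (constS c)))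
      where c = inv1 BOps (qfact m 0)

    Dψ-term-suc : ∀ k → Dψ m (term (suc k)) s.≈ term k s.⊗ Dψ m F
    Dψ-term-suc k = begin
      Dψ m (term (suc k))
        ≈⟨ Dψ-⊗-const (P (suc k)) (inv1 BOps (qfact m (suc k))) ⟩
      Dψ m (P (suc k)) s.⊗ c′
        ≈⟨ s.*-congʳ {c′} (proj₂ (proj₂ isDP k)) ⟩
      ((c s.⊗ P k) s.⊗ Dψ m F) s.⊗ c′
        ≈⟨ s.solve 4 (λ a b d e → ((a s.· b) s.· d) s.· e s.⊜ (b s.· (a s.· e)) s.· d) s.refl c (P k) (Dψ m F) c′ ⟩
      (P k s.⊗ (c s.⊗ c′)) s.⊗ Dψ m F
        ≈⟨ s.*-congʳ {Dψ m F} (s.*-congˡ {P k} c⊗c′≈[k]!⁻¹) ⟩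
      term k s.⊗ Dψ m F ∎
      where
      open s using (begin_; step-≈-⟩; _∎)
      c = constS (qint m (suc k))
      c′ = constS (inv1 BOps (qfact m (suc k)))
      c⊗c′≈[k]!⁻¹ : c s.⊗ c′ s.≈ constS (inv1 BOps (qfact m k))
      c⊗c′≈[k]!⁻¹ = s.trans (TS.const-⊗-const (qint m (suc k)) (inv1 BOps (qfact m (suc k))))
                            (TS.const-cong ([1+n]⊗[n]!⁻¹≈[n]!⁻¹ k))

    Dψ-expPartial : ∀ N → Dψ m (expPartial m P (suc N)) s.≈ expPartial m P N s.⊗ Dψ m F
    Dψ-expPartial N = begin
      Dψ m (expPartial m P (suc N))                             ≈⟨ Dψ-sum (suc N) term ⟩
      s.sumUpTo (suc N) (λ k → Dψ m (term k))                    ≈⟨ s.sum-unfoldˡ N _ ⟩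
      Dψ m (term 0) s.⊕ s.sumUpTo N (λ k → Dψ m (term (suc k))) ≈⟨ s.+-cong Dψ-term-zero (s.sum-cong N Dψ-term-suc) ⟩
      s.𝟘 s.⊕ s.sumUpTo N (λ k → term k s.⊗ Dψ m F)              ≈⟨ s.+-identityˡ _ ⟩
      s.sumUpTo N (λ k → term k s.⊗ Dψ m F)                      ≈⟨ s.sym (s.⊗-distribʳ-sum N (Dψ m F) term) ⟩
      expPartial m P N s.⊗ Dψ m F                                ∎
      where open s using (begin_; step-≈-⟩; _∎)

    Dψ-E : Dψ m E s.≈ E s.⊗ Dψ m F
    Dψ-E n = begin
      Dψ m E n                                                ≈⟨ Dψ-coeff E n ⟩
      qint m (suc n) r.⊗ expPartial m P (suc (suc n)) (suc n) ≈⟨ r.sym (Dψ-coeff (expPartial m P (suc (suc n))) n) ⟩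
      Dψ m (expPartial m P (suc (suc n))) n                   ≈⟨ Dψ-expPartial (suc n) n ⟩
      (expPartial m P (suc n) s.⊗ Dψ m F) n                   ≈⟨ TS.coeff-⊗-congˡ n (expPartial m P (suc n)) E (Dψ m F) E≈ ⟩
      (E s.⊗ Dψ m F) n                                        ∎
      where
      open r using (begin_; step-≈-⟩; _∎)
      E≈ : ∀ i → i ≤ n → expPartial m P (suc n) i r.≈ E i
      E≈ i i≤n = ≡.subst (λ N → expPartial m P N i r.≈ E i) (ℕ.m∸n+n≡m (s≤s i≤n)) (expPartial-stable i (n ∸ i))

    prodPartial⟶E : Converges (prodPartial m F) E
    prodPartial⟶E = ProductFormula.prodPartial⟶G F E E₀≈1 Dψ-E

proposition8p2 : (m : ℕ) → 1 ≤ m → (F : S) → NoConst F →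
    Σ (ℕ → S) (IsDivPowers m F) ×
    ((P : ℕ → S) → IsDivPowers m F P →
      Σ S (λ G →
        Converges (expPartial m P) G ×
        NoConst (SS._⊕_ G (SS.⊖_ SS.𝟙)) ×
        Converges (prodPartial m F) G))
proposition8p2 m 1≤m F _ = (divPowers F , divPowers-isDivPowers F) ,
  λ P isDP → let open Exponential F P isDP in E , expPartial⟶E , E⊖1-noConst , prodPartial⟶E
  where open QCalculus m 1≤m
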